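{- Let $t$ and $\Delta$ be non-negative integers, let $H$ be a $t$-tree, let $I$ be a graph of maximum degree $\Delta$, and let $G$ be a subgraph of the strong product $H\boxtimes I$. Then $G$ has an odd colouring using at most $(\Delta^2+\Delta)(t+1)+2t+1$ colours.
   Context: All graphs are finite and simple. A $t$-tree is a graph that is either a clique on $t+1$ vertices, or a graph $H$ containing a vertex $v$ of degree $t$ whose neighbours form a clique and such that $H-\{v\}$ is a $t$-tree. For graphs $A$ and $B$, the strong product $A\boxtimes B$ has vertex set $V(A)\times V(B)$, and $(x_1,y_1)(x_2,y_2)$ is an edge iff (i) $x_1x_2\in E(A)$ and $y_1=y_2$, or (ii) $x_1=x_2$ and $y_1y_2\in E(B)$, or (iii) $x_1x_2\in E(A)$ and $y_1y_2\in E(B)$. A vertex colouring $\varphi:V(G)\to\mathbb{N}$ (not necessarily proper) is odd if for every vertex $v$ with $|N_G(v)|>0$ there is a colour $\alpha$ such that $|\{w\in N_G(v):\varphi(w)=\alpha\}|$ is odd. A colouring uses $c$ colours if $|\{\varphi(v):v\in V(G)\}|=c$. -}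

module Defs where

open import Data.Nat using (ℕ; zero; suc; _+_; _*_; _^_; _≤_; _<_; _≡ᵇ_)
open import Data.Nat.Properties using (_≟_)
open import Data.Bool using (Bool; true; false; _∧_; _∨_; if_then_else_)
open import Data.Fin using (Fin; punchIn)
open import Data.Fin.Properties using () renaming (_≟_ to _≟F_)
open import Data.List using (List; length; map; filter; deduplicate)
open import Data.List.Base using (allFin)
open import Data.Product using (_×_; _,_; ∃-syntax; Σ)
open import Relation.Binary.PropositionalEquality using (_≡_; _≢_)
open import Relation.Nullary.Decidable using (⌊_⌋)
open import Function.Definitions using (Injective)

record Graph : Set where
  field
    n      : ℕ
    adj    : Fin n → Fin n → Bool
    sym    : ∀ x y → adj x y ≡ adj y x
    irrefl : ∀ x → adj x x ≡ false
open Graph public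

countᵇ : {m : ℕ} → (Fin m → Bool) → ℕ
countᵇ {m} p = length (filter (λ x → Data.Bool._≟_ (p x) true) (allFin m))

degree : (G : Graph) → Fin (n G) → ℕ
degree G v = countᵇ (adj G v)

HasMaxDegree : Graph → ℕ → Set
HasMaxDegree G Δ = (∀ v → degree G v ≤ Δ) × (∃[ v ] degree G v ≡ Δ)

IsCliqueOn : (G : Graph) → (Fin (n G) → Bool) → Set
IsCliqueOn G S = ∀ x y → S x ≡ true → S y ≡ true → x ≢ y → adj G x y ≡ true

deleteVertex : (G : Graph) {m : ℕ} → n G ≡ suc m → Fin (suc m) → Graph
deleteVertex record { n = .(suc m) ; adj = a ; sym = s ; irrefl = i } {m} _≡_.refl v =
  record { n = m
         ; adj = λ x y → a (punchIn v x) (punchIn v y)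
         ; sym = λ x y → s (punchIn v x) (punchIn v y)
         ; irrefl = λ x → i (punchIn v x) }

data IsTTree (t : ℕ) : Graph → Set where
  clique : (G : Graph) → n G ≡ suc t →
           (∀ x y → x ≢ y → adj G x y ≡ true) → IsTTree t G
  extend : (G : Graph) {m : ℕ} (e : n G ≡ suc m) (v : Fin (n G)) →
           degree G v ≡ t →
           IsCliqueOn G (adj G v) →
           IsTTree t (deleteVertex G e (Data.Fin.cast e v)) →
           IsTTree t G

strongAdj : (A B : Graph) → Fin (n A) × Fin (n B) → Fin (n A) × Fin (n B) → Bool
strongAdj A B (x₁ , y₁) (x₂ , y₂) =
  (adj A x₁ x₂ ∧ ⌊ y₁ ≟F y₂ ⌋) ∨ (⌊ x₁ ≟F x₂ ⌋ ∧ adj B y₁ y₂) ∨ (adj A x₁ x₂ ∧ adj B y₁ y₂)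

IsSubgraphOfStrongProduct : Graph → Graph → Graph → Set
IsSubgraphOfStrongProduct G A B =
  Σ (Fin (n G) → Fin (n A) × Fin (n B)) λ f →
    Injective _≡_ _≡_ f ×
    (∀ u w → adj G u w ≡ true → strongAdj A B (f u) (f w) ≡ true)

colourCount : (G : Graph) → (Fin (n G) → ℕ) → Fin (n G) → ℕ → ℕ
colourCount G φ v α = countᵇ (λ w → adj G v w ∧ (φ w ≡ᵇ α))

data Odd : ℕ → Set where
  one : Odd 1
  ss  : ∀ {k} → Odd k → Odd (suc (suc k))

IsOddColouring : (G : Graph) → (Fin (n G) → ℕ) → Set
IsOddColouring G φ = ∀ v → 0 < degree G v → ∃[ α ] Odd (colourCount G φ v α)

coloursUsed : (G : Graph) → (Fin (n G) → ℕ) → ℕ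
coloursUsed G φ = length (deduplicate _≟_ (map φ (allFin (n G))))

-- Order the vertices of the t-tree H by a perfect elimination ordering, so that every
-- vertex has at most t lower neighbours and these form a clique, and let the pivot of a vertex u of G
-- be a neighbour of u of least rank (of its H-coordinate). Call a and z in conflict when some common
-- neighbour u of a and z has one of them as its pivot. A colouring that separates conflicting
-- vertices is odd: the colour of the pivot of u occurs exactly once around u. Colouring greedily in
-- order of rank, a vertex z has conflicts with earlier vertices only at the positions
--   lower(x) × B₂(y),   {x} × (B₂(y) ∖ {y}),   pivot(u) for u ∈ G with f u ∈ lower(x) × B₁(y),
-- where f z = (x , y) for the embedding f of G into H ⊠ I and Bᵣ is the ball of radius r in I;
-- the first case uses that two lower neighbours of a common vertex of H are adjacent. This gives
-- at most t (Δ² + 1) + Δ² + t (Δ + 1) earlier conflicts, hence that many colours plus one.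
module Submission where

open import Defs hiding (sym)
open import Data.Nat using (ℕ; zero; suc; _+_; _*_; _^_; _≤_; _<_; z≤n; s≤s; _≡ᵇ_; _<?_)
open import Data.Nat.Properties
  using (≤-refl; ≤-reflexive; ≤-trans; <-asym; ≤-pred; ≤-antisym; <-irrefl; <-≤-trans; <-cmp;
         ≮⇒≥; ≤∧≢⇒<;
         m≤n⇒m≤1+n; m≤m+n; +-mono-≤; *-mono-≤; *-monoˡ-≤; +-monoʳ-<; +-comm; +-cancelˡ-≡;
         ≡ᵇ⇒≡; ≡⇒≡ᵇ; module ≤-Reasoning)
  renaming (_≟_ to _≟ℕ_)
open import Data.Nat.Solver using (module +-*-Solver)
open import Data.Bool using (true; false; _∧_)
open import Data.Bool.Properties using (T-≡)
import Data.Bool as Bool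
open import Data.Fin as Fin using (Fin; toℕ; punchIn; cast)
open import Data.Vec.Functional using (insertAt)
open import Data.Vec.Functional.Properties using (insertAt-lookup; insertAt-punchIn)
open import Data.Fin.Properties
  using (toℕ<n; toℕ-injective; punchIn-punchOut; cast-is-id; any?)
open import Data.List
  using (List; []; _∷_; length; map; filter; allFin; upTo; _++_; concatMap; cartesianProduct; deduplicate)
open import Data.List.Properties
  using (length-map; length-++; length-tabulate; length-upTo; length-removeAt′; filter-notAll)
open import Data.List.Relation.Unary.Any as Any using (here; there; index)
import Data.List.Relation.Unary.All as All
open import Data.List.Relation.Unary.AllPairs using (_∷_)
open import Data.List.Relation.Unary.Unique.Propositional using (Unique)
open import Data.List.Relation.Unary.Unique.Propositional.Properties using (allFin⁺; upTo⁺; filter⁺; map⁺)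
open import Data.List.Relation.Unary.Unique.DecPropositional.Properties _≟ℕ_ using (deduplicate-!)
open import Data.List.Membership.Propositional using (_∈_; _∉_; _─_; find; lose)
open import Data.List.Membership.Propositional.Properties
  using (∈-filter⁺; ∈-filter⁻; ∈-map⁺; ∈-map⁻; ∈-allFin; ∈-upTo⁺; ∈-upTo⁻; ∈-length;
         ∈-++⁺ˡ; ∈-++⁺ʳ; ∈-concatMap⁺; ∈-cartesianProduct⁺; ∈-deduplicate⁻)
open import Data.List.Membership.DecPropositional _≟ℕ_ using (_∈?_)
open import Data.List.Relation.Binary.Subset.Propositional using (_⊆_)
open import Data.List.Extrema.Nat using (argmin; argmin-all; f[argmin]≤f[⊤]; f[argmin]≤f[xs])
open import Data.Product using (Σ; ∃-syntax; _×_; _,_; proj₁; proj₂)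
open import Data.Sum using (_⊎_; inj₁; inj₂)
import Data.Sum
open import Function using (_∘_; case_of_)
open import Function.Bundles using (Equivalence)
open import Function.Definitions using (Injective)
open import Relation.Binary.Definitions using (Decidable; tri<; tri≈; tri>)
open import Relation.Binary.PropositionalEquality
  using (_≡_; _≢_; refl; sym; trans; cong; cong₂; subst; subst₂)
open import Relation.Nullary using (Dec; yes; no; ¬?; contradiction)
open import Relation.Nullary.Decidable using (_×-dec_; _⊎-dec_; decidable-stable)

module _ {A : Set} where

  ∈-─⁺ : ∀ {x y : A} {ys} (x∈ys : x ∈ ys) → y ∈ ys → y ≢ x → y ∈ ys ─ x∈ys
  ∈-─⁺ (here refl) (here refl) y≢x = contradiction refl y≢x
  ∈-─⁺ (here refl) (there y∈ys) _  = y∈ys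
  ∈-─⁺ (there _)   (here refl)  _  = here refl
  ∈-─⁺ (there x∈ys) (there y∈ys) y≢x = there (∈-─⁺ x∈ys y∈ys y≢x)

  Unique-⊆⇒length≤ : ∀ {xs ys : List A} → Unique xs → xs ⊆ ys → length xs ≤ length ys
  Unique-⊆⇒length≤ {[]}     _                _     = z≤n
  Unique-⊆⇒length≤ {x ∷ xs} {ys} (x∉xs ∷ xs!) xs⊆ys = begin
    suc (length xs)          ≤⟨ s≤s (Unique-⊆⇒length≤ xs! xs⊆ys─x) ⟩
    suc (length (ys ─ x∈ys)) ≡⟨ sym (length-removeAt′ ys (index x∈ys)) ⟩
    length ys                ∎
    where
    open ≤-Reasoning
    x∈ys : x ∈ ys
    x∈ys = xs⊆ys (here refl)
    xs⊆ys─x : xs ⊆ ys ─ x∈ys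
    xs⊆ys─x z∈xs = ∈-─⁺ x∈ys (xs⊆ys (there z∈xs)) (λ z≡x → All.lookup x∉xs z∈xs (sym z≡x))

  0<length⇒∃∈ : ∀ {xs : List A} → 0 < length xs → ∃[ x ] x ∈ xs
  0<length⇒∃∈ {x ∷ _} _ = x , here refl

  length-cartesianProduct : ∀ {B : Set} (xs : List A) (ys : List B) →
                            length (cartesianProduct xs ys) ≡ length xs * length ys
  length-cartesianProduct []       ys = refl
  length-cartesianProduct (x ∷ xs) ys = trans (length-++ (map (x ,_) ys))
    (cong₂ _+_ (length-map (x ,_) ys) (length-cartesianProduct xs ys))

  length-concatMap≤ : ∀ {B : Set} (g : A → List B) {c} (xs : List A) →
                      (∀ {x} → x ∈ xs → length (g x) ≤ c) → length (concatMap g xs) ≤ length xs * c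
  length-concatMap≤ g []       _      = z≤n
  length-concatMap≤ g (x ∷ xs) g≤c = subst (_≤ _) (sym (length-++ (g x)))
    (+-mono-≤ (g≤c (here refl)) (length-concatMap≤ g xs (g≤c ∘ there)))

length≤-by-injection : ∀ {A B : Set} {f : A → B} → Injective _≡_ _≡_ f → ∀ {xs ys} → Unique xs →
                       (∀ {x} → x ∈ xs → f x ∈ ys) → length xs ≤ length ys
length≤-by-injection {f = f} f-injective {xs} xs! f[xs]⊆ys =
  subst (_≤ _) (length-map f xs) (Unique-⊆⇒length≤ (map⁺ f-injective xs!) image⊆ys)
  where
  image⊆ys : map f xs ⊆ _
  image⊆ys y∈ with ∈-map⁻ f y∈
  ... | _ , x∈xs , refl = f[xs]⊆ys x∈xs

module _ {A : Set} (f : A → ℕ) where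

  argminOr : A → List A → A
  argminOr d []       = d
  argminOr d (x ∷ xs) = argmin f x xs

  argminOr-∈ : ∀ d {x xs} → x ∈ xs → argminOr d xs ∈ xs
  argminOr-∈ d {xs = y ∷ ys} _ = argmin-all f (here refl) (All.tabulate there)

  f[argminOr]≤ : ∀ d {x xs} → x ∈ xs → f (argminOr d xs) ≤ f x
  f[argminOr]≤ d {xs = y ∷ ys} (here refl) = f[argmin]≤f[⊤] {f = f} y ys
  f[argminOr]≤ d {xs = y ∷ ys} (there x∈ys) = All.lookup (f[argmin]≤f[xs] {f = f} y ys) x∈ys

∃-fresh : (xs : List ℕ) → ∃[ c ] c ≤ length xs × c ∉ xs
∃-fresh xs with Any.any? (λ c → ¬? (c ∈? xs)) (upTo (suc (length xs)))
... | yes some = let c , c∈upTo , c∉xs = find some in c , ≤-pred (∈-upTo⁻ c∈upTo) , c∉xs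
... | no none  = contradiction
  (subst (_≤ length xs) (length-upTo _) (Unique-⊆⇒length≤ (upTo⁺ _) upTo⊆xs)) (<-irrefl refl)
  where
  upTo⊆xs : upTo (suc (length xs)) ⊆ xs
  upTo⊆xs {c} c∈upTo = decidable-stable (c ∈? xs) (λ c∉xs → none (lose c∈upTo c∉xs))

fresh : List ℕ → ℕ
fresh xs = proj₁ (∃-fresh xs)

fresh≤length : ∀ xs → fresh xs ≤ length xs
fresh≤length xs = proj₁ (proj₂ (∃-fresh xs))

fresh∉ : ∀ xs → fresh xs ∉ xs
fresh∉ xs = proj₂ (proj₂ (∃-fresh xs))

neighbours : (G : Graph) → Fin (n G) → List (Fin (n G))
neighbours G v = filter (λ w → adj G v w Bool.≟ true) (allFin (n G))

module _ (G : Graph) where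

  ∈-neighbours⁺ : ∀ {v w} → adj G v w ≡ true → w ∈ neighbours G v
  ∈-neighbours⁺ {v} {w} vw = ∈-filter⁺ (λ w → adj G v w Bool.≟ true) (∈-allFin w) vw

  ∈-neighbours⁻ : ∀ {v w} → w ∈ neighbours G v → adj G v w ≡ true
  ∈-neighbours⁻ {v} w∈ = proj₂ (∈-filter⁻ (λ w → adj G v w Bool.≟ true) {xs = allFin (n G)} w∈)

  adj-sym : ∀ {v w} → adj G v w ≡ true → adj G w v ≡ true
  adj-sym {v} {w} vw = trans (Graph.sym G w v) vw

  adj⇒≢ : ∀ {v w} → adj G v w ≡ true → v ≢ w
  adj⇒≢ {v} vw refl with trans (sym vw) (irrefl G v)
  ... | ()

  degree<n : ∀ v → degree G v < n G
  degree<n v = subst (degree G v <_) (length-tabulate {n = n G} (λ w → w))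
    (filter-notAll (λ w → adj G v w Bool.≟ true) (allFin (n G)) (lose (∈-allFin v) (λ vv → adj⇒≢ vv refl)))

  AdjOrEq : Fin (n G) → Fin (n G) → Set
  AdjOrEq v w = v ≡ w ⊎ adj G v w ≡ true

  AdjOrEq-sym : ∀ {v w} → AdjOrEq v w → AdjOrEq w v
  AdjOrEq-sym (inj₁ v≡w) = inj₁ (sym v≡w)
  AdjOrEq-sym (inj₂ vw)  = inj₂ (adj-sym vw)

  colourCount≡1 : ∀ (φ : Fin (n G) → ℕ) {u w} → adj G u w ≡ true →
                  (∀ {w′} → adj G u w′ ≡ true → φ w′ ≡ φ w → w′ ≡ w) → colourCount G φ u (φ w) ≡ 1
  colourCount≡1 φ {u} {w} uw unique = ≤-antisym
    (Unique-⊆⇒length≤ (filter⁺ P? (allFin⁺ (n G))) sameColour⊆[w]) (∈-length w∈sameColour)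
    where
    P? : ∀ w′ → Dec ((adj G u w′ ∧ (φ w′ ≡ᵇ φ w)) ≡ true)
    P? w′ = (adj G u w′ ∧ (φ w′ ≡ᵇ φ w)) Bool.≟ true
    w∈sameColour : w ∈ filter P? (allFin (n G))
    w∈sameColour = ∈-filter⁺ P? (∈-allFin w)
      (subst (λ b → (b ∧ (φ w ≡ᵇ φ w)) ≡ true) (sym uw)
        (Equivalence.to T-≡ (≡⇒≡ᵇ (φ w) (φ w) refl)))
    sameColour⊆[w] : filter P? (allFin (n G)) ⊆ w ∷ []
    sameColour⊆[w] {w′} w′∈ with adj G u w′ in uw′ | proj₂ (∈-filter⁻ P? {xs = allFin (n G)} w′∈)
    ... | true | sameColour = here (unique uw′ (≡ᵇ⇒≡ (φ w′) (φ w) (Equivalence.from T-≡ sameColour)))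
    ... | false | ()

coloursUsed≤ : ∀ (G : Graph) (φ : Fin (n G) → ℕ) {k} → (∀ v → φ v < k) → coloursUsed G φ ≤ k
coloursUsed≤ G φ {k} φ<k = subst (coloursUsed G φ ≤_) (length-upTo k)
  (Unique-⊆⇒length≤ (deduplicate-! (map φ (allFin (n G)))) colours⊆upTo)
  where
  colours⊆upTo : deduplicate _≟ℕ_ (map φ (allFin (n G))) ⊆ upTo k
  colours⊆upTo c∈ with ∈-map⁻ φ (∈-deduplicate⁻ _≟ℕ_ (map φ (allFin (n G))) c∈)
  ... | v , _ , refl = ∈-upTo⁺ (φ<k v)

strongAdj⇒AdjOrEq : ∀ (A B : Graph) {x₁ y₁ x₂ y₂} → strongAdj A B (x₁ , y₁) (x₂ , y₂) ≡ true →
                    AdjOrEq A x₁ x₂ × AdjOrEq B y₁ y₂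
strongAdj⇒AdjOrEq A B {x₁} {y₁} {x₂} {y₂} e
  with adj A x₁ x₂ | adj B y₁ y₂ | x₁ Fin.≟ x₂ | y₁ Fin.≟ y₂
... | true  | true  | _            | _            = inj₂ refl , inj₂ refl
... | true  | false | _            | yes y₁≡y₂    = inj₂ refl , inj₁ y₁≡y₂
... | false | true  | yes x₁≡x₂    | _            = inj₁ x₁≡x₂ , inj₂ refl
... | true  | false | yes _        | no _         = case e of λ ()
... | true  | false | no _         | no _         = case e of λ ()
... | false | true  | no _         | _            = case e of λ ()
... | false | false | yes _        | _            = case e of λ ()
... | false | false | no _         | _            = case e of λ ()

module Balls (I : Graph) {Δ : ℕ} (degree≤Δ : ∀ y → degree I y ≤ Δ) where

  dist≤1 : Fin (n I) → List (Fin (n I))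
  dist≤1 y = y ∷ neighbours I y

  ∈-dist≤1 : ∀ {y y₁} → AdjOrEq I y y₁ → y₁ ∈ dist≤1 y
  ∈-dist≤1 (inj₁ refl) = here refl
  ∈-dist≤1 (inj₂ yy₁)  = there (∈-neighbours⁺ I yy₁)

  length-dist≤1 : ∀ y → length (dist≤1 y) ≤ suc Δ
  length-dist≤1 y = s≤s (degree≤Δ y)

  _≢?_ : (v y : Fin (n I)) → Dec (v ≢ y)
  v ≢? y = ¬? (v Fin.≟ y)

  viaNeighbour : Fin (n I) → Fin (n I) → List (Fin (n I))
  viaNeighbour y w = w ∷ filter (_≢? y) (neighbours I w)

  0<dist≤2 : Fin (n I) → List (Fin (n I))
  0<dist≤2 y = concatMap (viaNeighbour y) (neighbours I y)

  ∈-0<dist≤2 : ∀ {y y₁ y₂} → AdjOrEq I y y₁ → AdjOrEq I y₁ y₂ → y₂ ≢ y → y₂ ∈ 0<dist≤2 y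
  ∈-0<dist≤2 (inj₁ refl) (inj₁ refl) y≢y = contradiction refl y≢y
  ∈-0<dist≤2 (inj₁ refl) (inj₂ yy₂)  _   = ∈-concatMap⁺ _ (lose (∈-neighbours⁺ I yy₂) (here refl))
  ∈-0<dist≤2 (inj₂ yy₁)  (inj₁ refl) _   = ∈-concatMap⁺ _ (lose (∈-neighbours⁺ I yy₁) (here refl))
  ∈-0<dist≤2 {y} (inj₂ yy₁) (inj₂ y₁y₂) y₂≢y = ∈-concatMap⁺ _ (lose (∈-neighbours⁺ I yy₁)
    (there (∈-filter⁺ (_≢? y) (∈-neighbours⁺ I y₁y₂) y₂≢y)))

  -- y itself is among the neighbours of w and is filtered out.
  length-viaNeighbour : ∀ {y w} → adj I y w ≡ true → length (viaNeighbour y w) ≤ Δ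
  length-viaNeighbour {y} {w} yw = ≤-trans
    (filter-notAll (_≢? y) (neighbours I w) (lose (∈-neighbours⁺ I (adj-sym I yw)) (λ y≢y → y≢y refl)))
    (degree≤Δ w)

  length-0<dist≤2 : ∀ y → length (0<dist≤2 y) ≤ Δ * Δ
  length-0<dist≤2 y = ≤-trans
    (length-concatMap≤ (viaNeighbour y) (neighbours I y) (length-viaNeighbour ∘ ∈-neighbours⁻ I))
    (*-monoˡ-≤ Δ (degree≤Δ y))

  dist≤2 : Fin (n I) → List (Fin (n I))
  dist≤2 y = y ∷ 0<dist≤2 y

  ∈-dist≤2 : ∀ {y y₁ y₂} → AdjOrEq I y y₁ → AdjOrEq I y₁ y₂ → y₂ ∈ dist≤2 y
  ∈-dist≤2 {y} {y₂ = y₂} yy₁ y₁y₂ with y₂ Fin.≟ y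
  ... | yes y₂≡y = here y₂≡y
  ... | no  y₂≢y = there (∈-0<dist≤2 yy₁ y₁y₂ y₂≢y)

  length-dist≤2 : ∀ y → length (dist≤2 y) ≤ suc (Δ * Δ)
  length-dist≤2 y = s≤s (length-0<dist≤2 y)

record EliminationOrdering (t : ℕ) (H : Graph) : Set where
  field
    rank           : Fin (n H) → ℕ
    rank<n         : ∀ x → rank x < n H
    rank-injective : Injective _≡_ _≡_ rank
    lower          : Fin (n H) → List (Fin (n H))
    length-lower≤t : ∀ x → length (lower x) ≤ t
    ∈-lower        : ∀ {x y} → adj H x y ≡ true → rank y < rank x → y ∈ lower x
    lower-clique   : ∀ {x y z} → adj H x y ≡ true → adj H x z ≡ true →
                     rank y < rank x → rank z < rank x → y ≢ z → adj H y z ≡ true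

module _ {t} {H : Graph} (O : EliminationOrdering t H) where
  open EliminationOrdering O

  adj-below-common : ∀ {c x b} → AdjOrEq H c x → AdjOrEq H c b →
                     rank b < rank x → rank x ≤ rank c → adj H x b ≡ true
  adj-below-common (inj₁ refl) (inj₁ refl) b<x _   = contradiction b<x (<-irrefl refl)
  adj-below-common (inj₁ refl) (inj₂ cb)   _   _   = cb
  adj-below-common (inj₂ _)    (inj₁ refl) b<x x≤c = contradiction (<-≤-trans b<x x≤c) (<-irrefl refl)
  adj-below-common {c} {x} {b} (inj₂ cx) (inj₂ cb) b<x x≤c = lower-clique cx cb x<c (<-≤-trans b<x x≤c) x≢b
    where
    x<c : rank x < rank c
    x<c = ≤∧≢⇒< x≤c (λ eq → adj⇒≢ H cx (rank-injective (sym eq)))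
    x≢b : x ≢ b
    x≢b x≡b = <-irrefl (cong rank (sym x≡b)) b<x

clique-ordering : ∀ {t} (H : Graph) → n H ≡ suc t → (∀ x y → x ≢ y → adj H x y ≡ true) →
                  EliminationOrdering t H
clique-ordering H refl complete = record
  { rank           = toℕ
  ; rank<n         = toℕ<n
  ; rank-injective = toℕ-injective
  ; lower          = neighbours H
  ; length-lower≤t = λ x → ≤-pred (degree<n H x)
  ; ∈-lower        = λ xy _ → ∈-neighbours⁺ H xy
  ; lower-clique   = λ _ _ _ _ y≢z → complete _ _ y≢z
  }

data PunchInView {m} (w : Fin (suc m)) : Fin (suc m) → Set where
  at-w    : PunchInView w w
  punched : (z : Fin m) → PunchInView w (punchIn w z)

punchInView : ∀ {m} (w z : Fin (suc m)) → PunchInView w z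
punchInView w z with z Fin.≟ w
... | yes refl = at-w
... | no  z≢w  = subst (PunchInView w) (punchIn-punchOut (z≢w ∘ sym)) (punched _)

extend-ordering : ∀ {t} (H : Graph) {m} (e : n H ≡ suc m) (w : Fin (n H)) → degree H w ≡ t →
                  IsCliqueOn H (adj H w) → EliminationOrdering t (deleteVertex H e (cast e w)) →
                  EliminationOrdering t H
extend-ordering {t} H {m} refl w deg-w clique-w O′ with cast refl w | cast-is-id refl w
... | .w | refl = record
  { rank           = rank
  ; rank<n         = rank<n
  ; rank-injective = rank-injective
  ; lower          = lower
  ; length-lower≤t = length-lower≤t
  ; ∈-lower        = ∈-lower
  ; lower-clique   = lower-clique
  }
  where
  module O′ = EliminationOrdering O′

  rank : Fin (suc m) → ℕ
  rank = insertAt O′.rank w m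

  lower : Fin (suc m) → List (Fin (suc m))
  lower = insertAt (map (punchIn w) ∘ O′.lower) w (neighbours H w)

  rank-punched : ∀ z → rank (punchIn w z) ≡ O′.rank z
  rank-punched = insertAt-punchIn O′.rank w m

  w-on-top : ∀ z → rank (punchIn w z) < rank w
  w-on-top z = subst₂ _<_ (sym (rank-punched z)) (sym (insertAt-lookup O′.rank w m)) (O′.rank<n z)

  rank<n : ∀ x → rank x < suc m
  rank<n x with punchInView w x
  ... | at-w      = subst (_< suc m) (sym (insertAt-lookup O′.rank w m)) ≤-refl
  ... | punched z = m≤n⇒m≤1+n (subst (_< m) (sym (rank-punched z)) (O′.rank<n z))

  rank-injective : Injective _≡_ _≡_ rank
  rank-injective {x} {y} eq with punchInView w x | punchInView w y
  ... | at-w      | at-w      = refl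
  ... | at-w      | punched z = contradiction (w-on-top z) (<-irrefl (sym eq))
  ... | punched z | at-w      = contradiction (w-on-top z) (<-irrefl eq)
  ... | punched z | punched z′ =
    cong (punchIn w) (O′.rank-injective (trans (sym (rank-punched z)) (trans eq (rank-punched z′))))

  length-lower≤t : ∀ x → length (lower x) ≤ t
  length-lower≤t x with punchInView w x
  ... | at-w      = subst (λ ys → length ys ≤ t) (sym (insertAt-lookup _ w _)) (≤-reflexive deg-w)
  ... | punched z = subst (λ ys → length ys ≤ t) (sym (insertAt-punchIn _ w _ z))
                      (subst (_≤ t) (sym (length-map (punchIn w) (O′.lower z))) (O′.length-lower≤t z))

  ∈-lower : ∀ {x y} → adj H x y ≡ true → rank y < rank x → y ∈ lower x
  ∈-lower {x} {y} xy y<x with punchInView w x | punchInView w y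
  ... | at-w      | _          = subst (y ∈_) (sym (insertAt-lookup _ w _)) (∈-neighbours⁺ H xy)
  ... | punched z | at-w       = contradiction (w-on-top z) (<-asym y<x)
  ... | punched z | punched z′ = subst (punchIn w z′ ∈_) (sym (insertAt-punchIn _ w _ z))
    (∈-map⁺ (punchIn w) (O′.∈-lower xy (subst₂ _<_ (rank-punched z′) (rank-punched z) y<x)))

  lower-clique : ∀ {x y z} → adj H x y ≡ true → adj H x z ≡ true →
                 rank y < rank x → rank z < rank x → y ≢ z → adj H y z ≡ true
  lower-clique {x} {y} {z} xy xz y<x z<x y≢z with punchInView w x | punchInView w y | punchInView w z
  ... | at-w       | _          | _          = clique-w y z xy xz y≢z
  ... | punched x′ | at-w       | _          = contradiction (w-on-top x′) (<-asym y<x)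
  ... | punched x′ | punched _  | at-w       = contradiction (w-on-top x′) (<-asym z<x)
  ... | punched x′ | punched y′ | punched z′ = O′.lower-clique xy xz
    (subst₂ _<_ (rank-punched y′) (rank-punched x′) y<x)
    (subst₂ _<_ (rank-punched z′) (rank-punched x′) z<x)
    (y≢z ∘ cong (punchIn w))

ttree⇒ordering : ∀ {t H} → IsTTree t H → EliminationOrdering t H
ttree⇒ordering (clique H e complete)           = clique-ordering H e complete
ttree⇒ordering (extend H e v deg-v clique-v H-v) = extend-ordering H e v deg-v clique-v (ttree⇒ordering H-v)

module GreedyColouring {N : ℕ} {C : Fin N → Fin N → Set} (C? : Decidable C) (key : Fin N → ℕ) where

  earlier? : ∀ z a → Dec (C a z × key a < key z)
  earlier? z a = C? a z ×-dec key a <? key z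

  earlier : Fin N → List (Fin N)
  earlier z = filter (earlier? z) (allFin N)

  -- colouringAt s is final on the vertices of key below s and still 0 on the others.
  colouringAt : ℕ → Fin N → ℕ
  colouringAt zero    z = 0
  colouringAt (suc s) z with key z ≟ℕ s
  ... | yes _ = fresh (map (colouringAt s) (earlier z))
  ... | no  _ = colouringAt s z

  colouring : Fin N → ℕ
  colouring z = colouringAt (suc (key z)) z

  colouring-unfold : ∀ z → colouring z ≡ fresh (map (colouringAt (key z)) (earlier z))
  colouring-unfold z with key z ≟ℕ key z
  ... | yes _  = refl
  ... | no  ≢z = contradiction refl ≢z

  colouringAt-stable : ∀ {s z} → key z < s → colouringAt s z ≡ colouring z
  colouringAt-stable {suc s} {z} z<1+s with key z ≟ℕ s
  ... | yes refl = sym (colouring-unfold z)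
  ... | no  z≢s  = colouringAt-stable (≤∧≢⇒< (≤-pred z<1+s) z≢s)

  colouring≤ : ∀ z → colouring z ≤ length (earlier z)
  colouring≤ z = begin
    colouring z                  ≡⟨ colouring-unfold z ⟩
    fresh earlierColours         ≤⟨ fresh≤length earlierColours ⟩
    length earlierColours        ≡⟨ length-map _ (earlier z) ⟩
    length (earlier z)           ∎
    where
    open ≤-Reasoning
    earlierColours : List ℕ
    earlierColours = map (colouringAt (key z)) (earlier z)

  colouring-proper-< : ∀ {a z} → C a z → key a < key z → colouring a ≢ colouring z
  colouring-proper-< {a} {z} c a<z a≡z = fresh∉ (map (colouringAt (key z)) (earlier z))
    (subst (_∈ map (colouringAt (key z)) (earlier z)) colour-a≡colour-z
      (∈-map⁺ (colouringAt (key z)) (∈-filter⁺ (earlier? z) (∈-allFin a) (c , a<z))))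
    where
    colour-a≡colour-z : colouringAt (key z) a ≡ fresh (map (colouringAt (key z)) (earlier z))
    colour-a≡colour-z = trans (colouringAt-stable a<z) (trans a≡z (colouring-unfold z))

  colouring-proper : (∀ {a z} → C a z → C z a) → (∀ {a z} → C a z → a ≢ z) → Injective _≡_ _≡_ key →
                     ∀ {a z} → C a z → colouring a ≢ colouring z
  colouring-proper C-sym C-irrefl key-injective {a} {z} c with <-cmp (key a) (key z)
  ... | tri< a<z _ _ = colouring-proper-< c a<z
  ... | tri≈ _ a≡z _ = contradiction (key-injective a≡z) (C-irrefl c)
  ... | tri> _ _ z<a = colouring-proper-< (C-sym c) z<a ∘ sym

module LexicographicKey {N : ℕ} (ρ : Fin N → ℕ) where

  key : Fin N → ℕ
  key z = ρ z * N + toℕ z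

  key-mono : ∀ {a z} → ρ a < ρ z → key a < key z
  key-mono {a} {z} ρa<ρz = begin-strict
    ρ a * N + toℕ a <⟨ +-monoʳ-< (ρ a * N) (toℕ<n a) ⟩
    ρ a * N + N     ≡⟨ +-comm (ρ a * N) N ⟩
    suc (ρ a) * N   ≤⟨ *-monoˡ-≤ N ρa<ρz ⟩
    ρ z * N         ≤⟨ m≤m+n (ρ z * N) (toℕ z) ⟩
    key z           ∎
    where open ≤-Reasoning

  key<⇒ρ≤ : ∀ {a z} → key a < key z → ρ a ≤ ρ z
  key<⇒ρ≤ {a} {z} a<z with ρ z <? ρ a
  ... | yes ρz<ρa = contradiction a<z (<-asym (key-mono ρz<ρa))
  ... | no  ρz≮ρa = ≮⇒≥ ρz≮ρa

  key-injective : Injective _≡_ _≡_ key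
  key-injective {a} {z} a≡z with <-cmp (ρ a) (ρ z)
  ... | tri< ρa<ρz _ _ = contradiction (key-mono ρa<ρz) (<-irrefl a≡z)
  ... | tri> _ _ ρz<ρa = contradiction (key-mono ρz<ρa) (<-irrefl (sym a≡z))
  ... | tri≈ _ ρa≡ρz _ = toℕ-injective (+-cancelˡ-≡ (ρ a * N) (toℕ a) (toℕ z)
    (trans a≡z (cong (λ r → r * N + toℕ z) (sym ρa≡ρz))))

conflictBound : ℕ → ℕ → ℕ
conflictBound t Δ = t * suc (Δ * Δ) + (Δ * Δ + t * suc Δ)

conflictBound<colours : ∀ t Δ → suc (conflictBound t Δ) ≤ (Δ ^ 2 + Δ) * (t + 1) + 2 * t + 1
conflictBound<colours t Δ = subst (suc (conflictBound t Δ) ≤_) (sym colours≡) (m≤m+n _ Δ)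
  where
  open +-*-Solver
  colours≡ : (Δ ^ 2 + Δ) * (t + 1) + 2 * t + 1 ≡ suc (conflictBound t Δ) + Δ
  colours≡ = solve 2 (λ t Δ → (Δ :^ 2 :+ Δ) :* (t :+ con 1) :+ con 2 :* t :+ con 1
                           := con 1 :+ (t :* (con 1 :+ Δ :* Δ) :+ (Δ :* Δ :+ t :* (con 1 :+ Δ))) :+ Δ) refl t Δ

module Construction {t Δ : ℕ} (H I G : Graph) (O : EliminationOrdering t H) (degree≤Δ : ∀ y → degree I y ≤ Δ)
  (f : Fin (n G) → Fin (n H) × Fin (n I)) (f-injective : Injective _≡_ _≡_ f)
  (f-adj : ∀ u w → adj G u w ≡ true → strongAdj H I (f u) (f w) ≡ true) where

  open EliminationOrdering O
  open Balls I degree≤Δ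

  N : ℕ
  N = n G

  πH : Fin N → Fin (n H)
  πH z = proj₁ (f z)

  πI : Fin N → Fin (n I)
  πI z = proj₂ (f z)

  ρ : Fin N → ℕ
  ρ z = rank (πH z)

  adj⇒nearH : ∀ {u w} → adj G u w ≡ true → AdjOrEq H (πH u) (πH w)
  adj⇒nearH {u} {w} uw = proj₁ (strongAdj⇒AdjOrEq H I (f-adj u w uw))

  adj⇒nearI : ∀ {u w} → adj G u w ≡ true → AdjOrEq I (πI u) (πI w)
  adj⇒nearI {u} {w} uw = proj₂ (strongAdj⇒AdjOrEq H I (f-adj u w uw))

  pivot : Fin N → Fin N
  pivot u = argminOr ρ u (neighbours G u)

  pivot-adj : ∀ {u w} → adj G u w ≡ true → adj G u (pivot u) ≡ true
  pivot-adj {u} uw = ∈-neighbours⁻ G (argminOr-∈ ρ u (∈-neighbours⁺ G uw))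

  pivot-min : ∀ {u w} → adj G u w ≡ true → ρ (pivot u) ≤ ρ w
  pivot-min {u} uw = f[argminOr]≤ ρ u (∈-neighbours⁺ G uw)

  Conflict : Fin N → Fin N → Set
  Conflict a z = a ≢ z × ∃[ u ] adj G u a ≡ true × adj G u z ≡ true × (pivot u ≡ a ⊎ pivot u ≡ z)

  Conflict? : Decidable Conflict
  Conflict? a z = ¬? (a Fin.≟ z) ×-dec any? λ u →
    adj G u a Bool.≟ true ×-dec adj G u z Bool.≟ true ×-dec (pivot u Fin.≟ a ⊎-dec pivot u Fin.≟ z)

  Conflict-sym : ∀ {a z} → Conflict a z → Conflict z a
  Conflict-sym (a≢z , u , ua , uz , pivot-u) = a≢z ∘ sym , u , uz , ua , Data.Sum.swap pivot-u

  open LexicographicKey ρ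
  open GreedyColouring Conflict? key public

  below? : ∀ z u → Dec (πH u ∈ lower (πH z) × πI u ∈ dist≤1 (πI z))
  below? z u = Any.any? (πH u Fin.≟_) (lower (πH z)) ×-dec Any.any? (πI u Fin.≟_) (dist≤1 (πI z))

  below : Fin N → List (Fin N)
  below z = filter (below? z) (allFin N)

  length-below : ∀ z → length (below z) ≤ t * suc Δ
  length-below z = begin
    length (below z)                              ≤⟨ length≤-by-injection f-injective
                                                       (filter⁺ (below? z) (allFin⁺ N)) f[below]⊆ ⟩
    length (cartesianProduct (lower x) (dist≤1 y)) ≡⟨ length-cartesianProduct (lower x) (dist≤1 y) ⟩
    length (lower x) * length (dist≤1 y)          ≤⟨ *-mono-≤ (length-lower≤t x) (length-dist≤1 y) ⟩
    t * suc Δ                                     ∎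
    where
    open ≤-Reasoning
    x : Fin (n H)
    x = πH z
    y : Fin (n I)
    y = πI z
    f[below]⊆ : ∀ {u} → u ∈ below z → f u ∈ cartesianProduct (lower x) (dist≤1 y)
    f[below]⊆ u∈ = let _ , πHu∈ , πIu∈ = ∈-filter⁻ (below? z) {xs = allFin N} u∈
                   in ∈-cartesianProduct⁺ πHu∈ πIu∈

  lowerCandidates columnCandidates pivotCandidates candidates : Fin N → List (Fin (n H) × Fin (n I))
  lowerCandidates z  = cartesianProduct (lower (πH z)) (dist≤2 (πI z))
  columnCandidates z = map (πH z ,_) (0<dist≤2 (πI z))
  pivotCandidates z  = map (f ∘ pivot) (below z)
  candidates z       = lowerCandidates z ++ columnCandidates z ++ pivotCandidates z

  length-candidates : ∀ z → length (candidates z) ≤ conflictBound t Δ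
  length-candidates z = begin
    length (candidates z)
      ≡⟨ length-++ (lowerCandidates z) ⟩
    length (lowerCandidates z) + length (columnCandidates z ++ pivotCandidates z)
      ≡⟨ cong (length (lowerCandidates z) +_) (length-++ (columnCandidates z)) ⟩
    length (lowerCandidates z) + (length (columnCandidates z) + length (pivotCandidates z))
      ≡⟨ cong₂ _+_ (length-cartesianProduct (lower x) (dist≤2 y))
                   (cong₂ _+_ (length-map _ (0<dist≤2 y)) (length-map _ (below z))) ⟩
    length (lower x) * length (dist≤2 y) + (length (0<dist≤2 y) + length (below z))
      ≤⟨ +-mono-≤ (*-mono-≤ (length-lower≤t x) (length-dist≤2 y))
                  (+-mono-≤ (length-0<dist≤2 y) (length-below z)) ⟩
    conflictBound t Δ ∎
    where
    open ≤-Reasoning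
    x : Fin (n H)
    x = πH z
    y : Fin (n I)
    y = πI z

  same-column⇒candidate : ∀ {a z u} → a ≢ z → adj G u a ≡ true → adj G u z ≡ true → πH a ≡ πH z →
                          f a ∈ columnCandidates z
  same-column⇒candidate {a} {z} a≢z ua uz same =
    subst (λ x → (x , πI a) ∈ columnCandidates z) (sym same)
      (∈-map⁺ (πH z ,_) (∈-0<dist≤2 (AdjOrEq-sym I (adj⇒nearI uz)) (adj⇒nearI ua)
        (λ πI-same → a≢z (f-injective (cong₂ _,_ same πI-same)))))

  pivot-of-lower⇒candidate : ∀ {z u} → adj G u z ≡ true → ρ u < ρ z → f (pivot u) ∈ pivotCandidates z
  pivot-of-lower⇒candidate {z} {u} uz ρu<ρz = ∈-map⁺ (f ∘ pivot) (∈-filter⁺ (below? z) (∈-allFin u)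
    (∈-lower (adj-sym H z~u) ρu<ρz , ∈-dist≤1 (AdjOrEq-sym I (adj⇒nearI uz))))
    where
    z~u : adj H (πH u) (πH z) ≡ true
    z~u with adj⇒nearH uz
    ... | inj₁ same     = contradiction ρu<ρz (<-irrefl (cong rank same))
    ... | inj₂ adjacent = adjacent

  lower-row⇒candidate : ∀ {a z u} → adj G u a ≡ true → adj G u z ≡ true → ρ a < ρ z → ρ z ≤ ρ u →
                        f a ∈ lowerCandidates z
  lower-row⇒candidate ua uz ρa<ρz ρz≤ρu = ∈-cartesianProduct⁺
    (∈-lower (adj-below-common O (adj⇒nearH uz) (adj⇒nearH ua) ρa<ρz ρz≤ρu) ρa<ρz)
    (∈-dist≤2 (AdjOrEq-sym I (adj⇒nearI uz)) (adj⇒nearI ua))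

  conflict⇒candidate : ∀ {a z} → Conflict a z → ρ a ≤ ρ z → f a ∈ candidates z
  conflict⇒candidate {z = z} (a≢z , u , ua , uz , inj₂ refl) ρa≤ρz =
    ∈-++⁺ʳ (lowerCandidates z) (∈-++⁺ˡ
      (same-column⇒candidate a≢z ua uz (rank-injective (≤-antisym ρa≤ρz (pivot-min ua)))))
  conflict⇒candidate {a} {z} (a≢z , u , ua , uz , inj₁ refl) ρa≤ρz with ρ u <? ρ z | πH a Fin.≟ πH z
  ... | yes ρu<ρz | _        = ∈-++⁺ʳ (lowerCandidates z) (∈-++⁺ʳ (columnCandidates z)
                                 (pivot-of-lower⇒candidate uz ρu<ρz))
  ... | no  _     | yes same = ∈-++⁺ʳ (lowerCandidates z) (∈-++⁺ˡ (same-column⇒candidate a≢z ua uz same))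
  ... | no  ρu≮ρz | no  diff = ∈-++⁺ˡ
    (lower-row⇒candidate ua uz (≤∧≢⇒< ρa≤ρz (diff ∘ rank-injective)) (≮⇒≥ ρu≮ρz))

  length-earlier : ∀ z → length (earlier z) ≤ conflictBound t Δ
  length-earlier z = ≤-trans
    (length≤-by-injection f-injective (filter⁺ (earlier? z) (allFin⁺ N)) λ a∈ →
      let _ , conflict , a<z = ∈-filter⁻ (earlier? z) {xs = allFin N} a∈
      in conflict⇒candidate conflict (key<⇒ρ≤ a<z))
    (length-candidates z)

  colouring-odd : IsOddColouring G colouring
  colouring-odd u 0<deg = colouring (pivot u) , subst Odd (sym (colourCount≡1 G colouring u~pivot unique)) one
    where
    u~pivot : adj G u (pivot u) ≡ true
    u~pivot = pivot-adj (∈-neighbours⁻ G (proj₂ (0<length⇒∃∈ 0<deg)))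
    unique : ∀ {w} → adj G u w ≡ true → colouring w ≡ colouring (pivot u) → w ≡ pivot u
    unique {w} uw same with w Fin.≟ pivot u
    ... | yes w≡pivot = w≡pivot
    ... | no  w≢pivot = contradiction (sym same)
      (colouring-proper Conflict-sym proj₁ key-injective (w≢pivot ∘ sym , u , u~pivot , uw , inj₁ refl))

  colouring<colours : ∀ z → colouring z < suc (conflictBound t Δ)
  colouring<colours z = s≤s (≤-trans (colouring≤ z) (length-earlier z))

theorem5 : (t Δ : ℕ) (H I G : Graph) → IsTTree t H → HasMaxDegree I Δ →
    IsSubgraphOfStrongProduct G H I →
    Σ (Fin (n G) → ℕ) λ φ → IsOddColouring G φ ×
    (coloursUsed G φ ≤ (Δ ^ 2 + Δ) * (t + 1) + 2 * t + 1)
theorem5 t Δ H I G H-tree (degree≤Δ , _) (f , f-injective , f-adj) =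
  colouring , colouring-odd ,
  ≤-trans (coloursUsed≤ G colouring colouring<colours) (conflictBound<colours t Δ)
  where open Construction H I G (ttree⇒ordering H-tree) degree≤Δ f f-injective f-adj
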